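{- There exist universal constants $c,\delta>0$ such that for every sufficiently large $n$ the following holds. Let $G$ be a (simple) graph on $n$ vertices, and let the edges of $G$ be colored with $n$ colors so that each color class is a matching consisting of exactly $2$ edges. Then there exist a set $S\subseteq V(G)$ with $|S|\le cn$ and a rainbow set $F$ of edges of $G$ with $|F|\ge (c+\delta)n$ such that every edge of $F$ has both endpoints in $S$.
   Context: A set of edges is rainbow if its edges have pairwise distinct colors. The edge coloring need not be proper. -}

module Defs where

open import Data.Nat using (ℕ)
open import Data.Fin using (Fin; zero; suc)
open import Data.Fin.Subset using (Subset; _∈_)
open import Data.Product using (_×_; _,_; proj₁; proj₂)
open import Data.Sum using (_⊎_)
open import Data.List using (List; map)
open import Data.List.Relation.Unary.All using (All)
open import Data.List.Relation.Unary.Unique.Propositional using (Unique)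
open import Relation.Binary.PropositionalEquality using (_≡_; _≢_)
open import Data.Integer using (+_)
open import Data.Rational using (ℚ; _/_)

Edge : ℕ → Set
Edge n = Fin n × Fin n

SameEdge : ∀ {n} → Edge n → Edge n → Set
SameEdge (a , b) (c , d) = ((a ≡ c) × (b ≡ d)) ⊎ ((a ≡ d) × (b ≡ c))

Disjoint : ∀ {n} → Edge n → Edge n → Set
Disjoint (a , b) (c , d) = (a ≢ c) × (a ≢ d) × (b ≢ c) × (b ≢ d)

-- The edge set of G is { edge i j | i : Fin n, j : Fin 2 }; the colour
-- class of colour i is { edge i 0 , edge i 1 }.
record ColouredGraph (n : ℕ) : Set where
  field
    edge     : Fin n → Fin 2 → Edge n
    loopless : ∀ i j → proj₁ (edge i j) ≢ proj₂ (edge i j)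
    -- all listed edges are pairwise distinct as unordered pairs
    -- (simple graph: no multi-edges; each class has exactly 2 edges)
    distinct : ∀ i j i' j' → SameEdge (edge i j) (edge i' j') → (i ≡ i') × (j ≡ j')
    matching : ∀ i → Disjoint (edge i zero) (edge i (suc zero))
open ColouredGraph public

-- A set F of edges of G is given as a list of edge labels (colour , index);
-- it is rainbow iff the colours of its members are pairwise distinct
-- (which also makes the members pairwise distinct edges, so |F| = length).
Rainbow : ∀ {n} → List (Fin n × Fin 2) → Set
Rainbow F = Unique (map proj₁ F)

SpannedBy : ∀ {n} → ColouredGraph n → Subset n → List (Fin n × Fin 2) → Set
SpannedBy G S F =
  All (λ e → (proj₁ (edge G (proj₁ e) (proj₂ e)) ∈ S)
           × (proj₂ (edge G (proj₁ e) (proj₂ e)) ∈ S)) F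

ℕ→ℚ : ℕ → ℚ
ℕ→ℚ m = (+ m) / 1

-- Call two vertices in conflict if they lie on the two different edges of one
-- colour class. A set T of vertices independent in this conflict graph meets at
-- most one edge of every colour, so choosing from each colour an edge avoiding T
-- gives a rainbow set F of n edges spanned by S = V ∖ T. Each colour contributes
-- at most 2·2 conflicting ordered pairs in each direction, so the conflict degrees
-- sum to at most 8n and at most half of the vertices have degree ≥ 16. A greedy
-- maximal independent set T among the remaining vertices dominates all of them,
-- each member of T dominating at most 16, hence |T| ≥ n/32. This gives
-- c = 31/32 and δ = 1/32.
module Submission where

open import Data.Bool.Base using (true; false; if_then_else_)
open import Data.Empty using (⊥)
open import Data.Fin.Base using (Fin; zero; suc)
open import Data.Fin.Properties using (_≟_; any?)
open import Data.Fin.Subset using (Subset; _∈_; _⊆_; ⁅_⁆; _∪_; ∁; ∣_∣)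
  renaming (⊥ to ∅)
open import Data.Fin.Subset.Properties
  using (_∈?_; ∉⊥; x∈⁅x⁆; x∈⁅y⁆⇒x≡y; x∈p∪q⁻; x∈p∪q⁺; x∉p⇒x∈∁p; ∣∁p∣≡n∸∣p∣)
open import Data.Integer.Base as ℤ using (+≤+)
import Data.Integer.Properties as ℤ
open import Data.List.Base using (List; []; _∷_; allFin; map; length)
open import Data.List.Membership.Propositional as List using ()
open import Data.List.Membership.Propositional.Properties using (∈-allFin)
open import Data.List.Properties using (map-∘; map-id; length-map; length-tabulate)
open import Data.List.Relation.Unary.All using (All)
import Data.List.Relation.Unary.All.Properties as All
open import Data.List.Relation.Unary.Any using (here; there)
open import Data.List.Relation.Unary.Unique.Propositional using (Unique)
open import Data.List.Relation.Unary.Unique.Propositional.Properties using (allFin⁺)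
open import Data.Nat.Base as ℕ using (ℕ; zero; suc; _+_; _*_; _∸_; _≤_; _≥_; z≤n; s≤s)
open import Data.Nat.Coprimality as Coprime using (1-coprimeTo)
open import Data.Nat.Properties
  using ( _≤?_; ≤-refl; ≤-reflexive; ≤-trans; ≰⇒>; m≤m+n; m≤n+m
        ; +-mono-≤; +-monoˡ-≤; +-monoʳ-≤; +-cancelʳ-≤; +-identityʳ
        ; *-mono-≤; *-monoˡ-≤; *-cancelʳ-≤; *-identityʳ; *-suc; *-comm; *-assoc
        ; *-distribʳ-∸; ∸-monoʳ-≤; m+n∸m≡n )
import Data.Nat.Properties as ℕ
open import Algebra.Properties.CommutativeSemigroup ℕ.*-commutativeSemigroup using (xy∙z≈xz∙y)
open import Algebra.Properties.Semiring.Sum ℕ.+-*-semiring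
open import Data.Product using (Σ; ∃; _×_; _,_; proj₁; proj₂)
open import Data.Rational.Base as ℚ using (ℚ; Positive; _/_; toℚᵘ)
open import Data.Rational.Properties using (toℚᵘ-cancel-≤; toℚᵘ-homo-*; normalize-coprime)
import Data.Rational.Properties as ℚ
open import Data.Rational.Unnormalised.Base as ℚᵘ using (mkℚᵘ; *≤*)
import Data.Rational.Unnormalised.Properties as ℚᵘ
open import Data.Sum using (_⊎_; inj₁; inj₂; [_,_])
open import Data.Vec.Base using ([]; _∷_)
open import Function.Base using (_∘_; id)
open import Relation.Binary.Core using (Rel)
open import Relation.Binary.Definitions using (Decidable; Symmetric)
open import Relation.Binary.PropositionalEquality
  using (_≡_; refl; cong; cong₂; sym; trans; subst; subst₂; module ≡-Reasoning)
open import Relation.Nullary using (¬_; Dec; yes; no; does; ¬?; _×-dec_; _⊎-dec_; contradiction)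

open import Defs

private variable
  n : ℕ

𝟙 : ∀ {a} {A : Set a} → Dec A → ℕ
𝟙 A? = if does A? then 1 else 0

𝟙≥1 : ∀ {a} {A : Set a} (A? : Dec A) → A → 1 ≤ 𝟙 A?
𝟙≥1 (yes _) _ = ≤-refl
𝟙≥1 (no ¬a) a = contradiction a ¬a

𝟙-≤ : ∀ {a} {A : Set a} (A? : Dec A) {m} → (A → 1 ≤ m) → 𝟙 A? ≤ m
𝟙-≤ (yes a) 1≤m = 1≤m a
𝟙-≤ (no _)  _   = z≤n

𝟙*-monoʳ-≤ : ∀ {a} {A : Set a} (A? : Dec A) {x y} → (A → x ≤ y) → 𝟙 A? * x ≤ 𝟙 A? * y
𝟙*-monoʳ-≤ (yes a) x≤y = +-monoˡ-≤ 0 (x≤y a)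
𝟙*-monoʳ-≤ (no _)  _   = z≤n

𝟙-⊎-≤ : ∀ {a b} {A : Set a} {B : Set b} (A? : Dec A) (B? : Dec B) → 𝟙 (A? ⊎-dec B?) ≤ 𝟙 A? + 𝟙 B?
𝟙-⊎-≤ (yes _) _       = s≤s z≤n
𝟙-⊎-≤ (no _)  (yes _) = ≤-refl
𝟙-⊎-≤ (no _)  (no _)  = z≤n

𝟙+𝟙¬≡1 : ∀ {a} {A : Set a} (A? : Dec A) → 𝟙 A? + 𝟙 (¬? A?) ≡ 1
𝟙+𝟙¬≡1 (yes _) = refl
𝟙+𝟙¬≡1 (no _)  = refl

∑-mono-≤ : {f g : Fin n → ℕ} → (∀ i → f i ≤ g i) → ∑[ i < n ] f i ≤ ∑[ i < n ] g i
∑-mono-≤ {zero}  f≤g = z≤n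
∑-mono-≤ {suc n} f≤g = +-mono-≤ (f≤g zero) (∑-mono-≤ (f≤g ∘ suc))

term≤∑ : (f : Fin n → ℕ) (i : Fin n) → f i ≤ ∑[ j < n ] f j
term≤∑ f zero    = m≤m+n (f zero) _
term≤∑ f (suc i) = ≤-trans (term≤∑ (f ∘ suc) i) (m≤n+m _ (f zero))

∑-const : ∀ n c → ∑[ i < n ] c ≡ n * c
∑-const zero    c = refl
∑-const (suc n) c = cong (c +_) (∑-const n c)

∑∑*-≤ : ∀ {m k a b} (f : Fin m → ℕ) (g : Fin k → ℕ) → ∑[ x < m ] f x ≤ a → ∑[ y < k ] g y ≤ b →
        ∑[ x < m ] ∑[ y < k ] (f x * g y) ≤ a * b
∑∑*-≤ {m} {k} f g ∑f≤a ∑g≤b = begin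
  ∑[ x < m ] ∑[ y < k ] (f x * g y)  ≡⟨ sum-cong-≗ (λ x → sym (*-distribˡ-sum (f x) g)) ⟩
  ∑[ x < m ] (f x * ∑[ y < k ] g y)  ≡⟨ sym (*-distribʳ-sum (∑[ y < k ] g y) f) ⟩
  ∑[ x < m ] f x * ∑[ y < k ] g y    ≤⟨ *-mono-≤ ∑f≤a ∑g≤b ⟩
  _                                  ∎
  where open ℕ.≤-Reasoning

∑𝟙≟ : (a : Fin n) → ∑[ x < n ] 𝟙 (x ≟ a) ≡ 1
∑𝟙≟ {suc n} zero    = cong suc (sum-replicate-zero n)
∑𝟙≟ {suc n} (suc a) = ∑𝟙≟ a

∑𝟙+∑𝟙¬≡n : ∀ {p} {P : Fin n → Set p} (P? : ∀ x → Dec (P x)) →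
           ∑[ x < n ] 𝟙 (P? x) + ∑[ x < n ] 𝟙 (¬? (P? x)) ≡ n
∑𝟙+∑𝟙¬≡n {n} P? = begin
  ∑[ x < n ] 𝟙 (P? x) + ∑[ x < n ] 𝟙 (¬? (P? x))  ≡⟨ sym (∑-distrib-+ (𝟙 ∘ P?) (𝟙 ∘ ¬? ∘ P?)) ⟩
  ∑[ x < n ] (𝟙 (P? x) + 𝟙 (¬? (P? x)))          ≡⟨ sum-cong-≗ (𝟙+𝟙¬≡1 ∘ P?) ⟩
  ∑[ x < n ] 1                                    ≡⟨ ∑-const n 1 ⟩
  n * 1                                           ≡⟨ *-identityʳ n ⟩
  n                                               ∎
  where open ≡-Reasoning

∣p∣≡∑𝟙∈ : (p : Subset n) → ∣ p ∣ ≡ ∑[ x < n ] 𝟙 (x ∈? p)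
∣p∣≡∑𝟙∈ []          = refl
∣p∣≡∑𝟙∈ (true ∷ p)  = cong suc (∣p∣≡∑𝟙∈ p)
∣p∣≡∑𝟙∈ (false ∷ p) = ∣p∣≡∑𝟙∈ p

∣∁p∣*suc-k≤n*k : ∀ k (p : Subset n) → n ≤ ∣ p ∣ * suc k → ∣ ∁ p ∣ * suc k ≤ n * k
∣∁p∣*suc-k≤n*k {n} k p n≤∣p∣*suc-k = begin
  ∣ ∁ p ∣ * suc k            ≡⟨ cong (_* suc k) (∣∁p∣≡n∸∣p∣ p) ⟩
  (n ∸ ∣ p ∣) * suc k        ≡⟨ *-distribʳ-∸ (suc k) n ∣ p ∣ ⟩
  n * suc k ∸ ∣ p ∣ * suc k  ≤⟨ ∸-monoʳ-≤ (n * suc k) n≤∣p∣*suc-k ⟩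
  n * suc k ∸ n              ≡⟨ cong (_∸ n) (*-suc n k) ⟩
  n + n * k ∸ n              ≡⟨ m+n∸m≡n n (n * k) ⟩
  n * k                      ∎
  where open ℕ.≤-Reasoning

n*2≤m+n⇒m+n≤m*2 : ∀ m n → n * 2 ≤ m + n → m + n ≤ m * 2
n*2≤m+n⇒m+n≤m*2 m n n*2≤m+n = begin
  m + n  ≤⟨ +-monoʳ-≤ m (+-cancelʳ-≤ n n m (≤-trans (≤-reflexive (double n)) n*2≤m+n)) ⟩
  m + m  ≡⟨ double m ⟩
  m * 2  ∎
  where
  open ℕ.≤-Reasoning
  double : ∀ k → k + k ≡ k * 2
  double k = trans (cong (k +_) (sym (*-identityʳ k))) (sym (*-suc k 1))

module SimpleGraph {ℓ} {_~_ : Rel (Fin n) ℓ} (_~?_ : Decidable _~_)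
                   (~-sym : Symmetric _~_) (~-irrefl : ∀ x → ¬ x ~ x) where

  degree : Fin n → ℕ
  degree x = ∑[ y < n ] 𝟙 (x ~? y)

  Independent : Subset n → Set ℓ
  Independent T = ∀ {x y} → x ∈ T → y ∈ T → ¬ x ~ y

  Dominates : Subset n → Fin n → Set ℓ
  Dominates T v = v ∈ T ⊎ ∃ λ t → t ∈ T × t ~ v

  dominates-mono : ∀ {T T′} → T ⊆ T′ → ∀ {v} → Dominates T v → Dominates T′ v
  dominates-mono T⊆T′ (inj₁ v∈T)             = inj₁ (T⊆T′ v∈T)
  dominates-mono T⊆T′ (inj₂ (t , t∈T , t~v)) = inj₂ (t , T⊆T′ t∈T , t~v)

  module _ (D : ℕ) where

    record LowDominatingIndependentSet (vs : List (Fin n)) : Set ℓ where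
      field
        set         : Subset n
        independent : Independent set
        low         : ∀ {t} → t ∈ set → degree t ≤ D
        dominating  : ∀ {v} → v List.∈ vs → degree v ≤ D → Dominates set v

    greedy : ∀ vs → LowDominatingIndependentSet vs
    greedy [] = record
      { set = ∅ ; independent = λ x∈∅ → contradiction x∈∅ ∉⊥ ; low = λ t∈∅ → contradiction t∈∅ ∉⊥
      ; dominating = λ () }
    greedy (v ∷ vs) with greedy vs
    ... | record { set = T ; independent = indep ; low = low ; dominating = dom }
        with degree v ≤? D | any? (λ t → t ∈? T ×-dec t ~? v)
    ...   | no high | _ = record
      { set = T ; independent = indep ; low = low
      ; dominating = λ { (here refl) low-v → contradiction low-v high ; (there w) → dom w } }
    ...   | yes _ | yes dominated = record
      { set = T ; independent = indep ; low = low
      ; dominating = λ { (here refl) _ → inj₂ dominated ; (there w) → dom w } }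
    ...   | yes low-v | no undominated = record
      { set = ⁅ v ⁆ ∪ T ; independent = indep′ ; low = low′ ; dominating = dom′ }
      where
      v-or-T : ∀ {x} → x ∈ ⁅ v ⁆ ∪ T → x ≡ v ⊎ x ∈ T
      v-or-T x∈ = [ inj₁ ∘ x∈⁅y⁆⇒x≡y v , inj₂ ] (x∈p∪q⁻ ⁅ v ⁆ T x∈)
      indep′ : Independent (⁅ v ⁆ ∪ T)
      indep′ x∈ y∈ with v-or-T x∈ | v-or-T y∈
      ... | inj₁ refl | inj₁ refl = ~-irrefl v
      ... | inj₁ refl | inj₂ y∈T  = λ v~y → undominated (_ , y∈T , ~-sym v~y)
      ... | inj₂ x∈T  | inj₁ refl = λ x~v → undominated (_ , x∈T , x~v)
      ... | inj₂ x∈T  | inj₂ y∈T  = indep x∈T y∈T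
      low′ : ∀ {t} → t ∈ ⁅ v ⁆ ∪ T → degree t ≤ D
      low′ t∈ = [ (λ { refl → low-v }) , low ] (v-or-T t∈)
      dom′ : ∀ {w} → w List.∈ v ∷ vs → degree w ≤ D → Dominates (⁅ v ⁆ ∪ T) w
      dom′ (here refl) _ = inj₁ (x∈p∪q⁺ (inj₁ (x∈⁅x⁆ v)))
      dom′ (there w) low-w = dominates-mono (x∈p∪q⁺ ∘ inj₂) (dom w low-w)

    dominated-count : ∀ {T} → (∀ {t} → t ∈ T → degree t ≤ D) → (∀ {v} → degree v ≤ D → Dominates T v) →
                      ∑[ v < n ] 𝟙 (degree v ≤? D) ≤ ∣ T ∣ * suc D
    dominated-count {T} low dom = begin
      ∑[ v < n ] 𝟙 (degree v ≤? D)                                      ≤⟨ ∑-mono-≤ covered ⟩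
      ∑[ v < n ] (𝟙 (v ∈? T) + ∑[ t < n ] (𝟙 (t ∈? T) * 𝟙 (t ~? v)))  ≡⟨ ∑-distrib-+ (λ v → 𝟙 (v ∈? T)) _ ⟩
      ∣T∣ + ∑[ v < n ] ∑[ t < n ] (𝟙 (t ∈? T) * 𝟙 (t ~? v))
        ≡⟨ cong (∣T∣ +_) (∑-comm (λ v t → 𝟙 (t ∈? T) * 𝟙 (t ~? v))) ⟩
      ∣T∣ + ∑[ t < n ] ∑[ v < n ] (𝟙 (t ∈? T) * 𝟙 (t ~? v))
        ≡⟨ cong (∣T∣ +_) (sum-cong-≗ (λ t → sym (*-distribˡ-sum (𝟙 (t ∈? T)) (λ v → 𝟙 (t ~? v))))) ⟩
      ∣T∣ + ∑[ t < n ] (𝟙 (t ∈? T) * degree t)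
        ≤⟨ +-monoʳ-≤ ∣T∣ (∑-mono-≤ (λ t → 𝟙*-monoʳ-≤ (t ∈? T) low)) ⟩
      ∣T∣ + ∑[ t < n ] (𝟙 (t ∈? T) * D)  ≡⟨ cong (∣T∣ +_) (sym (*-distribʳ-sum D (λ t → 𝟙 (t ∈? T)))) ⟩
      ∣T∣ + ∣T∣ * D                      ≡⟨ sym (*-suc ∣T∣ D) ⟩
      ∣T∣ * suc D                        ≡⟨ cong (_* suc D) (sym (∣p∣≡∑𝟙∈ T)) ⟩
      ∣ T ∣ * suc D                      ∎
      where
      open ℕ.≤-Reasoning
      ∣T∣ = ∑[ t < n ] 𝟙 (t ∈? T)
      covered : ∀ v → 𝟙 (degree v ≤? D) ≤ 𝟙 (v ∈? T) + ∑[ t < n ] (𝟙 (t ∈? T) * 𝟙 (t ~? v))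
      covered v = 𝟙-≤ (degree v ≤? D) λ low-v → [ in-T , neighbour-in-T ] (dom low-v)
        where
        in-T : v ∈ T → 1 ≤ 𝟙 (v ∈? T) + _
        in-T v∈T = ≤-trans (𝟙≥1 (v ∈? T) v∈T) (m≤m+n _ _)
        neighbour-in-T : (∃ λ t → t ∈ T × t ~ v) → 1 ≤ _ + ∑[ t < n ] (𝟙 (t ∈? T) * 𝟙 (t ~? v))
        neighbour-in-T (t , t∈T , t~v) = ≤-trans (*-mono-≤ (𝟙≥1 (t ∈? T) t∈T) (𝟙≥1 (t ~? v) t~v))
          (≤-trans (term≤∑ (λ t → 𝟙 (t ∈? T) * 𝟙 (t ~? v)) t) (m≤n+m _ _))

    high-degree-count : ∑[ v < n ] 𝟙 (¬? (degree v ≤? D)) * suc D ≤ ∑[ v < n ] degree v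
    high-degree-count = begin
      ∑[ v < n ] 𝟙 (¬? (degree v ≤? D)) * suc D    ≡⟨ *-distribʳ-sum (suc D) (λ v → 𝟙 (¬? (degree v ≤? D))) ⟩
      ∑[ v < n ] (𝟙 (¬? (degree v ≤? D)) * suc D)  ≤⟨ ∑-mono-≤ (λ v → high (degree v ≤? D)) ⟩
      ∑[ v < n ] degree v                           ∎
      where
      open ℕ.≤-Reasoning
      high : ∀ {v} (low? : Dec (degree v ≤ D)) → 𝟙 (¬? low?) * suc D ≤ degree v
      high (yes _)   = z≤n
      high (no ¬low) = ≤-trans (≤-reflexive (+-identityʳ (suc D))) (≰⇒> ¬low)

  sparse⇒large-independent-set : ∀ D → (∑[ v < n ] degree v) * 2 ≤ n * suc D →
                                 ∃ λ T → Independent T × n ≤ ∣ T ∣ * suc D * 2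
  sparse⇒large-independent-set D sparse = T , independent , (begin
    n                  ≡⟨ sym (∑𝟙+∑𝟙¬≡n (λ v → degree v ≤? D)) ⟩
    L + H              ≤⟨ n*2≤m+n⇒m+n≤m*2 L H few-high ⟩
    L * 2              ≤⟨ *-monoˡ-≤ 2 (dominated-count D low (dominating (∈-allFin _))) ⟩
    ∣ T ∣ * suc D * 2  ∎)
    where
    open ℕ.≤-Reasoning
    open LowDominatingIndependentSet (greedy D (allFin n)) renaming (set to T)
    L = ∑[ v < n ] 𝟙 (degree v ≤? D)
    H = ∑[ v < n ] 𝟙 (¬? (degree v ≤? D))
    few-high : H * 2 ≤ L + H
    few-high = *-cancelʳ-≤ (H * 2) (L + H) (suc D) (begin
      H * 2 * suc D              ≡⟨ xy∙z≈xz∙y H 2 (suc D) ⟩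
      H * suc D * 2              ≤⟨ *-monoˡ-≤ 2 (high-degree-count D) ⟩
      (∑[ v < n ] degree v) * 2  ≤⟨ sparse ⟩
      n * suc D                  ≡⟨ cong (_* suc D) (sym (∑𝟙+∑𝟙¬≡n (λ v → degree v ≤? D))) ⟩
      (L + H) * suc D            ∎)

_∈ₑ_ : Fin n → Edge n → Set
x ∈ₑ p = x ≡ proj₁ p ⊎ x ≡ proj₂ p

_∈ₑ?_ : (x : Fin n) (p : Edge n) → Dec (x ∈ₑ p)
x ∈ₑ? p = x ≟ proj₁ p ⊎-dec x ≟ proj₂ p

∑𝟙∈ₑ≤2 : (p : Edge n) → ∑[ x < n ] 𝟙 (x ∈ₑ? p) ≤ 2
∑𝟙∈ₑ≤2 {n} (a , b) = begin
  ∑[ x < n ] 𝟙 (x ∈ₑ? (a , b))                 ≤⟨ ∑-mono-≤ (λ x → 𝟙-⊎-≤ (x ≟ a) (x ≟ b)) ⟩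
  ∑[ x < n ] (𝟙 (x ≟ a) + 𝟙 (x ≟ b))          ≡⟨ ∑-distrib-+ (λ x → 𝟙 (x ≟ a)) (λ x → 𝟙 (x ≟ b)) ⟩
  ∑[ x < n ] 𝟙 (x ≟ a) + ∑[ x < n ] 𝟙 (x ≟ b)  ≡⟨ cong₂ _+_ (∑𝟙≟ a) (∑𝟙≟ b) ⟩
  2                                            ∎
  where open ℕ.≤-Reasoning

disjoint⇒¬shared : {p q : Edge n} → Disjoint p q → ∀ {x} → x ∈ₑ p → x ∈ₑ q → ⊥
disjoint⇒¬shared (a≢c , a≢d , b≢c , b≢d) (inj₁ refl) (inj₁ refl) = a≢c refl
disjoint⇒¬shared (a≢c , a≢d , b≢c , b≢d) (inj₁ refl) (inj₂ refl) = a≢d refl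
disjoint⇒¬shared (a≢c , a≢d , b≢c , b≢d) (inj₂ refl) (inj₁ refl) = b≢c refl
disjoint⇒¬shared (a≢c , a≢d , b≢c , b≢d) (inj₂ refl) (inj₂ refl) = b≢d refl

Spans : Subset n → Edge n → Set
Spans S p = proj₁ p ∈ S × proj₂ p ∈ S

touches-or-avoids : ∀ T (p : Edge n) → (∃ λ x → x ∈ₑ p × x ∈ T) ⊎ Spans (∁ T) p
touches-or-avoids T (a , b) with a ∈? T | b ∈? T
... | yes a∈T | _       = inj₁ (a , inj₁ refl , a∈T)
... | no _    | yes b∈T = inj₁ (b , inj₂ refl , b∈T)
... | no a∉T  | no b∉T  = inj₂ (x∉p⇒x∈∁p a∉T , x∉p⇒x∈∁p b∉T)

one-per-colour : {P : Fin n × Fin 2 → Set} → (∀ i → ∃ λ j → P (i , j)) →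
                 ∃ λ F → Rainbow F × length F ≡ n × All P F
one-per-colour {n} choose = F , rainbow , length-F , All.map⁺ (All.tabulate⁺ (proj₂ ∘ choose))
  where
  pick : Fin n → Fin n × Fin 2
  pick i = i , proj₁ (choose i)
  F = map pick (allFin n)
  rainbow : Rainbow F
  rainbow = subst Unique (sym (trans (sym (map-∘ (allFin n))) (map-id (allFin n)))) (allFin⁺ n)
  length-F : length F ≡ n
  length-F = trans (length-map pick (allFin n)) (length-tabulate id)

module _ (G : ColouredGraph n) where

  private
    e₀ e₁ : Fin n → Edge n
    e₀ i = edge G i zero
    e₁ i = edge G i (suc zero)

  Conflict : Rel (Fin n) _
  Conflict x y = ∃ λ i → (x ∈ₑ e₀ i × y ∈ₑ e₁ i) ⊎ (x ∈ₑ e₁ i × y ∈ₑ e₀ i)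

  conflict? : Decidable Conflict
  conflict? x y = any? λ i → (x ∈ₑ? e₀ i ×-dec y ∈ₑ? e₁ i) ⊎-dec (x ∈ₑ? e₁ i ×-dec y ∈ₑ? e₀ i)

  conflict-sym : Symmetric Conflict
  conflict-sym (i , inj₁ (x∈e₀ , y∈e₁)) = i , inj₂ (y∈e₁ , x∈e₀)
  conflict-sym (i , inj₂ (x∈e₁ , y∈e₀)) = i , inj₁ (y∈e₀ , x∈e₁)

  conflict-irrefl : ∀ x → ¬ Conflict x x
  conflict-irrefl x (i , inj₁ (x∈e₀ , x∈e₁)) = disjoint⇒¬shared (matching G i) x∈e₀ x∈e₁
  conflict-irrefl x (i , inj₂ (x∈e₁ , x∈e₀)) = disjoint⇒¬shared (matching G i) x∈e₀ x∈e₁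

  open SimpleGraph conflict? conflict-sym conflict-irrefl

  ∑degree≤n*8 : ∑[ x < n ] degree x ≤ n * 8
  ∑degree≤n*8 = begin
    ∑[ x < n ] ∑[ y < n ] 𝟙 (conflict? x y)        ≤⟨ ∑-mono-≤ (λ x → ∑-mono-≤ (λ y → 𝟙-≤ (conflict? x y) (witness x y))) ⟩
    ∑[ x < n ] ∑[ y < n ] ∑[ i < n ] pairs i x y  ≡⟨ sum-cong-≗ (λ x → ∑-comm (λ y i → pairs i x y)) ⟩
    ∑[ x < n ] ∑[ i < n ] ∑[ y < n ] pairs i x y  ≡⟨ ∑-comm (λ x i → ∑[ y < n ] pairs i x y) ⟩
    ∑[ i < n ] ∑[ x < n ] ∑[ y < n ] pairs i x y  ≤⟨ ∑-mono-≤ pairs≤8 ⟩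
    ∑[ i < n ] 8                                  ≡⟨ ∑-const n 8 ⟩
    n * 8                                         ∎
    where
    open ℕ.≤-Reasoning
    across : Edge n → Edge n → Fin n → Fin n → ℕ
    across p q x y = 𝟙 (x ∈ₑ? p) * 𝟙 (y ∈ₑ? q)
    ∑∑across≤4 : ∀ p q → ∑[ x < n ] ∑[ y < n ] across p q x y ≤ 4
    ∑∑across≤4 p q = ∑∑*-≤ (λ x → 𝟙 (x ∈ₑ? p)) (λ y → 𝟙 (y ∈ₑ? q)) (∑𝟙∈ₑ≤2 p) (∑𝟙∈ₑ≤2 q)
    pairs : Fin n → Fin n → Fin n → ℕ
    pairs i x y = across (e₀ i) (e₁ i) x y + across (e₁ i) (e₀ i) x y
    witness : ∀ x y → Conflict x y → 1 ≤ ∑[ i < n ] pairs i x y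
    witness x y (i , conflict) = ≤-trans (1≤pair conflict) (term≤∑ (λ i → pairs i x y) i)
      where
      1≤pair : (x ∈ₑ e₀ i × y ∈ₑ e₁ i) ⊎ (x ∈ₑ e₁ i × y ∈ₑ e₀ i) → 1 ≤ pairs i x y
      1≤pair (inj₁ (x∈e₀ , y∈e₁)) = ≤-trans (*-mono-≤ (𝟙≥1 (x ∈ₑ? e₀ i) x∈e₀) (𝟙≥1 (y ∈ₑ? e₁ i) y∈e₁)) (m≤m+n _ _)
      1≤pair (inj₂ (x∈e₁ , y∈e₀)) = ≤-trans (*-mono-≤ (𝟙≥1 (x ∈ₑ? e₁ i) x∈e₁) (𝟙≥1 (y ∈ₑ? e₀ i) y∈e₀)) (m≤n+m _ _)
    pairs≤8 : ∀ i → ∑[ x < n ] ∑[ y < n ] pairs i x y ≤ 8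
    pairs≤8 i = begin
      ∑[ x < n ] ∑[ y < n ] pairs i x y
        ≡⟨ sum-cong-≗ (λ x → ∑-distrib-+ (across (e₀ i) (e₁ i) x) (across (e₁ i) (e₀ i) x)) ⟩
      ∑[ x < n ] (∑[ y < n ] across (e₀ i) (e₁ i) x y + ∑[ y < n ] across (e₁ i) (e₀ i) x y)
        ≡⟨ ∑-distrib-+ (λ x → ∑[ y < n ] across (e₀ i) (e₁ i) x y) _ ⟩
      ∑[ x < n ] ∑[ y < n ] across (e₀ i) (e₁ i) x y + ∑[ x < n ] ∑[ y < n ] across (e₁ i) (e₀ i) x y
        ≤⟨ +-mono-≤ (∑∑across≤4 (e₀ i) (e₁ i)) (∑∑across≤4 (e₁ i) (e₀ i)) ⟩
      8 ∎

  ∑degree*2≤n*16 : (∑[ x < n ] degree x) * 2 ≤ n * 16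
  ∑degree*2≤n*16 = ≤-trans (*-monoˡ-≤ 2 ∑degree≤n*8) (≤-reflexive (*-assoc n 8 2))

  large-conflict-free-set : ∃ λ T → Independent T × n ≤ ∣ T ∣ * 32
  large-conflict-free-set with sparse⇒large-independent-set 15 ∑degree*2≤n*16
  ... | T , indep , n≤∣T∣*16*2 = T , indep , ≤-trans n≤∣T∣*16*2 (≤-reflexive (*-assoc ∣ T ∣ 16 2))

  conflict-free⇒avoiding-edge : ∀ {T} → Independent T → ∀ i → ∃ λ j → Spans (∁ T) (edge G i j)
  conflict-free⇒avoiding-edge {T} indep i with touches-or-avoids T (e₀ i) | touches-or-avoids T (e₁ i)
  ... | inj₂ e₀-avoids         | _                      = zero , e₀-avoids
  ... | inj₁ _                 | inj₂ e₁-avoids         = suc zero , e₁-avoids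
  ... | inj₁ (x , x∈e₀ , x∈T) | inj₁ (y , y∈e₁ , y∈T) = contradiction (i , inj₁ (x∈e₀ , y∈e₁)) (indep x∈T y∈T)

toℚᵘ-ℕ→ℚ : ∀ m → toℚᵘ (ℕ→ℚ m) ≡ mkℚᵘ (ℤ.+ m) 0
toℚᵘ-ℕ→ℚ m = cong toℚᵘ (normalize-coprime (Coprime.sym (1-coprimeTo m)))

ℕ→ℚ-≤-31/32 : ∀ a b → a * 32 ≤ b * 31 → ℕ→ℚ a ℚ.≤ (ℤ.+ 31 / 32) ℚ.* ℕ→ℚ b
ℕ→ℚ-≤-31/32 a b a*32≤b*31 = toℚᵘ-cancel-≤ (begin
  toℚᵘ (ℕ→ℚ a)                               ≡⟨ toℚᵘ-ℕ→ℚ a ⟩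
  mkℚᵘ (ℤ.+ a) 0                             ≤⟨ *≤* (subst₂ ℤ._≤_ (ℤ.pos-* a 32) +b*31≡ (+≤+ a*32≤b*31)) ⟩
  mkℚᵘ (ℤ.+ 31) 31 ℚᵘ.* mkℚᵘ (ℤ.+ b) 0       ≡⟨ cong (mkℚᵘ (ℤ.+ 31) 31 ℚᵘ.*_) (sym (toℚᵘ-ℕ→ℚ b)) ⟩
  toℚᵘ (ℤ.+ 31 / 32) ℚᵘ.* toℚᵘ (ℕ→ℚ b)       ≃⟨ ℚᵘ.≃-sym (toℚᵘ-homo-* (ℤ.+ 31 / 32) (ℕ→ℚ b)) ⟩
  toℚᵘ ((ℤ.+ 31 / 32) ℚ.* ℕ→ℚ b)             ∎)
  where
  open ℚᵘ.≤-Reasoning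
  +b*31≡ : ℤ.+ (b * 31) ≡ (ℤ.+ 31 ℤ.* ℤ.+ b) ℤ.* ℤ.+ 1
  +b*31≡ = sym (trans (ℤ.*-identityʳ _) (trans (sym (ℤ.pos-* 31 b)) (cong ℤ.+_ (*-comm 31 b))))

theorem3 : Σ ℚ λ c → Σ ℚ λ δ → Positive c × Positive δ ×
    ∃ λ N → ∀ n → n ≥ N → (G : ColouredGraph n) →
      Σ (Subset n) λ S → Σ (List (Fin n × Fin 2)) λ F →
        (ℕ→ℚ ∣ S ∣ ℚ.≤ c ℚ.* ℕ→ℚ n) ×
        Rainbow F ×
        ((c ℚ.+ δ) ℚ.* ℕ→ℚ n ℚ.≤ ℕ→ℚ (length F)) ×
        SpannedBy G S F
theorem3 = ℤ.+ 31 / 32 , ℤ.+ 1 / 32 , _ , _ , 0 , λ n _ G →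
  let T , conflict-free , n≤∣T∣*32 = large-conflict-free-set G
      F , rainbow , ∣F∣≡n , spanned = one-per-colour (conflict-free⇒avoiding-edge G conflict-free)
  in ∁ T , F , ℕ→ℚ-≤-31/32 ∣ ∁ T ∣ n (∣∁p∣*suc-k≤n*k 31 T n≤∣T∣*32) , rainbow ,
     -- c + δ normalises to 1ℚ
     ℚ.≤-reflexive (trans (ℚ.*-identityˡ (ℕ→ℚ n)) (cong ℕ→ℚ (sym ∣F∣≡n))) , spanned
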